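{- Let $V_1,V_2$ be disjoint finite sets and $\mathcal{H}^1\subseteq 2^{V_1}$, $\mathcal{H}^2\subseteq 2^{V_2}$ hypergraphs satisfying property (C). Then $\mathcal{H}=\mathcal{H}^1\otimes\mathcal{H}^2$ also satisfies property (C).
   Context: A hypergraph on a finite set $V$ is a family $\mathcal{H}\subseteq 2^V$ of nonempty edges covering $V$. A sequence of edges $H_0,\dots,H_q$ is a chain if for all $i=0,\dots,q-1$: $H_{i+1}\cap H_i\neq\emptyset$, $|H_{i+1}\setminus H_i|=1$ and $H_i\subseteq H_0\cup H_q$. Property (C): for any two distinct edges $H,H'$ there is a chain with $H_0=H$ and $H_q=H'$. Conjunctive compound: $\mathcal{H}^1\otimes\mathcal{H}^2=\{H^1\cup H^2\mid H^1\in\mathcal{H}^1,H^2\in\mathcal{H}^2\}$ on $V_1\cup V_2$. -}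

module Defs where

open import Data.Nat using (ℕ; suc)
open import Data.Fin using (Fin; zero; suc; fromℕ; inject₁)
open import Data.Fin.Subset
open import Data.Product using (Σ; ∃; ∃-syntax; _×_)
open import Relation.Binary.PropositionalEquality using (_≡_)
open import Relation.Nullary using (¬_)

Family : ℕ → Set₁
Family n = Subset n → Set

IsHypergraph : ∀ {n} → Subset n → Family n → Set
IsHypergraph {n} V ℋ =
  (∀ E → ℋ E → E ⊆ V) ×
  (∀ E → ℋ E → Nonempty E) ×
  (∀ x → x ∈ V → ∃[ E ] (ℋ E × x ∈ E))

record Chain {n} (ℋ : Family n) (H H' : Subset n) : Set where
  field
    q      : ℕ
    seq    : Fin (suc q) → Subset n
    edges  : ∀ i → ℋ (seq i)
    start  : seq zero ≡ H
    end    : seq (fromℕ q) ≡ H'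
    meets  : ∀ (i : Fin q) → Nonempty (seq (suc i) ∩ seq (inject₁ i))
    oneNew : ∀ (i : Fin q) → ∣ seq (suc i) ─ seq (inject₁ i) ∣ ≡ 1
    within : ∀ (i : Fin q) → seq (inject₁ i) ⊆ (seq zero ∪ seq (fromℕ q))

PropertyC : ∀ {n} → Family n → Set
PropertyC ℋ = ∀ H H' → ℋ H → ℋ H' → ¬ (H ≡ H') → Chain ℋ H H'

_⊗_ : ∀ {n} → Family n → Family n → Family n
(ℋ₁ ⊗ ℋ₂) E = ∃[ E₁ ] ∃[ E₂ ] (ℋ₁ E₁ × ℋ₂ E₂ × E ≡ E₁ ∪ E₂)

-- Write H = A₁ ∪ A₂ and H' = B₁ ∪ B₂. Follow a chain of ℋ₁ from A₁
-- to B₁ while keeping A₂ fixed, then a chain of ℋ₂ from A₂ to B₂ while keeping B₁ fixed.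
-- Since V₁ and V₂ are disjoint, adding a fixed part of the other side changes neither the
-- overlap of consecutive edges nor the single new vertex, and every intermediate edge stays
-- inside H ∪ H'.
module Submission where

open import Defs
open import Data.Nat using (ℕ; zero; suc)
open import Data.Bool using (true; false)
open import Data.Bool.Properties using (∨-identityʳ) renaming (_≟_ to _≟ᵇ_)
open import Data.Fin using (Fin; zero; suc; fromℕ; inject₁)
open import Data.Fin.Subset using (Subset; _∈_; _⊆_; _∩_; _∪_; _─_; ∣_∣; Nonempty; Empty)
open import Data.Fin.Subset.Properties
  using (⊆-refl; ⊆-trans; p⊆p∪q; q⊆p∪q; x∈p∪q⁻; x∈p∩q⁺; x∈p∩q⁻; ∪-comm; ∩-comm; drop-∷-Empty)
open import Data.Vec using (_∷_; []; here)
open import Data.Vec.Properties using (≡-dec)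
open import Data.Product using (_×_; _,_; proj₁; proj₂)
open import Data.Sum using ([_,_]′)
open import Data.Empty using (⊥-elim)
open import Function using (_∘_)
open import Relation.Binary.PropositionalEquality
  using (_≡_; refl; sym; trans; cong; subst; subst₂)
open import Relation.Nullary using (yes; no)

private
  variable
    n : ℕ
    p p′ q q′ r : Subset n

∪-⊆ : p ⊆ r → q ⊆ r → p ∪ q ⊆ r
∪-⊆ {p = p} {q = q} p⊆r q⊆r x∈p∪q = [ p⊆r , q⊆r ]′ (x∈p∪q⁻ p q x∈p∪q)

∩-mono-⊆ : p ⊆ p′ → q ⊆ q′ → p ∩ q ⊆ p′ ∩ q′
∩-mono-⊆ {p = p} {q = q} p⊆p′ q⊆q′ x∈p∩q =
  let x∈p , x∈q = x∈p∩q⁻ p q x∈p∩q in x∈p∩q⁺ (p⊆p′ x∈p , q⊆q′ x∈q)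

Nonempty-mono : p ⊆ q → Nonempty p → Nonempty q
Nonempty-mono p⊆q (x , x∈p) = x , p⊆q x∈p

Empty-∩-antimono : p ⊆ p′ → q ⊆ q′ → Empty (p′ ∩ q′) → Empty (p ∩ q)
Empty-∩-antimono p⊆p′ q⊆q′ empty = empty ∘ Nonempty-mono (∩-mono-⊆ p⊆p′ q⊆q′)

∪─∪-cancelʳ : ∀ (Y X C : Subset n) → Empty (Y ∩ C) → (Y ∪ C) ─ (X ∪ C) ≡ Y ─ X
∪─∪-cancelʳ [] [] [] _ = refl
∪─∪-cancelʳ (true ∷ Y) (x ∷ X) (true ∷ C) empty = ⊥-elim (empty (zero , here))
∪─∪-cancelʳ (false ∷ Y) (true ∷ X) (true ∷ C) empty =
  cong (false ∷_) (∪─∪-cancelʳ Y X C (drop-∷-Empty empty))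
∪─∪-cancelʳ (false ∷ Y) (false ∷ X) (true ∷ C) empty =
  cong (false ∷_) (∪─∪-cancelʳ Y X C (drop-∷-Empty empty))
∪─∪-cancelʳ (y ∷ Y) (true ∷ X) (false ∷ C) empty =
  cong (false ∷_) (∪─∪-cancelʳ Y X C (drop-∷-Empty empty))
∪─∪-cancelʳ (y ∷ Y) (false ∷ X) (false ∷ C) empty rewrite ∨-identityʳ y =
  cong (y ∷_) (∪─∪-cancelʳ Y X C (drop-∷-Empty empty))

∪─∪-cancelˡ : ∀ (Y X C : Subset n) → Empty (C ∩ Y) → (C ∪ Y) ─ (C ∪ X) ≡ Y ─ X
∪─∪-cancelˡ Y X C empty rewrite ∪-comm C Y | ∪-comm C X =
  ∪─∪-cancelʳ Y X C (subst Empty (∩-comm C Y) empty)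

Adjacent : Subset n → Subset n → Set
Adjacent X Y = Nonempty (Y ∩ X) × ∣ Y ─ X ∣ ≡ 1

Adjacent-∪ʳ : ∀ {X Y : Subset n} C → Empty (Y ∩ C) → Adjacent X Y → Adjacent (X ∪ C) (Y ∪ C)
Adjacent-∪ʳ {X = X} {Y} C empty (meet , new) =
  Nonempty-mono (∩-mono-⊆ (p⊆p∪q C) (p⊆p∪q C)) meet ,
  trans (cong ∣_∣ (∪─∪-cancelʳ Y X C empty)) new

Adjacent-∪ˡ : ∀ {X Y : Subset n} C → Empty (C ∩ Y) → Adjacent X Y → Adjacent (C ∪ X) (C ∪ Y)
Adjacent-∪ˡ {X = X} {Y} C empty (meet , new) =
  Nonempty-mono (∩-mono-⊆ (q⊆p∪q C Y) (q⊆p∪q C X)) meet ,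
  trans (cong ∣_∣ (∪─∪-cancelˡ Y X C empty)) new

-- Chains presented inductively; the bound S replaces the condition H_i ⊆ H_0 ∪ H_q.
data Walk (ℋ : Family n) (S : Subset n) : Subset n → Subset n → Set where
  stay : ∀ {X} → ℋ X → X ⊆ S → Walk ℋ S X X
  step : ∀ {X Y Z} → ℋ X → X ⊆ S → Adjacent X Y → Walk ℋ S Y Z → Walk ℋ S X Z

module _ {ℋ : Family n} {S : Subset n} where

  head-edge : ∀ {X Z} → Walk ℋ S X Z → ℋ X
  head-edge (stay X∈ℋ _) = X∈ℋ
  head-edge (step X∈ℋ _ _ _) = X∈ℋ

  _++_ : ∀ {X Y Z} → Walk ℋ S X Y → Walk ℋ S Y Z → Walk ℋ S X Z
  stay _ _ ++ w = w
  step X∈ℋ X⊆S adj v ++ w = step X∈ℋ X⊆S adj (v ++ w)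

  length : ∀ {X Z} → Walk ℋ S X Z → ℕ
  length (stay _ _) = zero
  length (step _ _ _ w) = suc (length w)

  vertex : ∀ {X Z} (w : Walk ℋ S X Z) → Fin (suc (length w)) → Subset n
  vertex {X = X} w zero = X
  vertex (step _ _ _ w) (suc i) = vertex w i

  vertex-edge : ∀ {X Z} (w : Walk ℋ S X Z) i → ℋ (vertex w i)
  vertex-edge w zero = head-edge w
  vertex-edge (step _ _ _ w) (suc i) = vertex-edge w i

  vertex-⊆ : ∀ {X Z} (w : Walk ℋ S X Z) i → vertex w i ⊆ S
  vertex-⊆ (stay _ X⊆S) zero = X⊆S
  vertex-⊆ (step _ X⊆S _ _) zero = X⊆S
  vertex-⊆ (step _ _ _ w) (suc i) = vertex-⊆ w i

  vertex-last : ∀ {X Z} (w : Walk ℋ S X Z) → vertex w (fromℕ (length w)) ≡ Z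
  vertex-last (stay _ _) = refl
  vertex-last (step _ _ _ w) = vertex-last w

  vertex-adjacent : ∀ {X Z} (w : Walk ℋ S X Z) (i : Fin (length w)) →
                    Adjacent (vertex w (inject₁ i)) (vertex w (suc i))
  vertex-adjacent (step _ _ adj _) zero = adj
  vertex-adjacent (step _ _ _ w) (suc i) = vertex-adjacent w i

  Walk⇒Chain : ∀ {X Z} (w : Walk ℋ S X Z) → S ⊆ X ∪ Z → Chain ℋ X Z
  Walk⇒Chain {X = X} {Z} w S⊆X∪Z = record
    { q      = length w
    ; seq    = vertex w
    ; edges  = vertex-edge w
    ; start  = refl
    ; end    = vertex-last w
    ; meets  = proj₁ ∘ vertex-adjacent w
    ; oneNew = proj₂ ∘ vertex-adjacent w
    ; within = λ i → subst (λ Z′ → vertex w (inject₁ i) ⊆ X ∪ Z′) (sym (vertex-last w))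
                       (S⊆X∪Z ∘ vertex-⊆ w (inject₁ i))
    }

map : ∀ {ℋ ℋ′ : Family n} {S S′} (f : Subset n → Subset n) →
      (∀ {X} → ℋ X → ℋ′ (f X)) → (∀ {X} → X ⊆ S → f X ⊆ S′) →
      (∀ {X Y} → ℋ Y → Adjacent X Y → Adjacent (f X) (f Y)) →
      ∀ {X Z} → Walk ℋ S X Z → Walk ℋ′ S′ (f X) (f Z)
map f edge bound adjacent (stay X∈ℋ X⊆S) = stay (edge X∈ℋ) (bound X⊆S)
map f edge bound adjacent (step X∈ℋ X⊆S adj w) =
  step (edge X∈ℋ) (bound X⊆S) (adjacent (head-edge w) adj) (map f edge bound adjacent w)

sequence⇒Walk : ∀ {ℋ : Family n} {S} q (seq : Fin (suc q) → Subset n) →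
  (∀ i → ℋ (seq i)) →
  (∀ (i : Fin q) → Adjacent (seq (inject₁ i)) (seq (suc i))) →
  (∀ (i : Fin q) → seq (inject₁ i) ⊆ S) → seq (fromℕ q) ⊆ S →
  Walk ℋ S (seq zero) (seq (fromℕ q))
sequence⇒Walk zero seq edges adjacent within last⊆S = stay (edges zero) last⊆S
sequence⇒Walk (suc q) seq edges adjacent within last⊆S =
  step (edges zero) (within zero) (adjacent zero)
    (sequence⇒Walk q (seq ∘ suc) (edges ∘ suc) (adjacent ∘ suc) (within ∘ suc) last⊆S)

Chain⇒Walk : ∀ {ℋ : Family n} {H H′} → Chain ℋ H H′ → Walk ℋ (H ∪ H′) H H′
Chain⇒Walk {H = H} {H′} c = subst₂ (Walk _ (H ∪ H′)) start end
  (sequence⇒Walk (Chain.q c) seq edges (λ i → meets i , oneNew i)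
    (λ i → subst₂ (λ A B → seq (inject₁ i) ⊆ A ∪ B) start end (within i))
    (q⊆p∪q H H′ ∘ subst (_ ∈_) end))
  where open Chain c hiding (q)

PropertyC⇒Walk : ∀ {ℋ : Family n} → PropertyC ℋ → ∀ {X Y} → ℋ X → ℋ Y → Walk ℋ (X ∪ Y) X Y
PropertyC⇒Walk C {X} {Y} X∈ℋ Y∈ℋ with ≡-dec _≟ᵇ_ X Y
... | yes refl = stay X∈ℋ (p⊆p∪q X)
... | no X≢Y = Chain⇒Walk (C X Y X∈ℋ Y∈ℋ X≢Y)

lemma9 : (n : ℕ) (V₁ V₂ : Subset n) (ℋ₁ ℋ₂ : Family n) →
    Empty (V₁ ∩ V₂) →
    IsHypergraph V₁ ℋ₁ → IsHypergraph V₂ ℋ₂ →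
    PropertyC ℋ₁ → PropertyC ℋ₂ →
    PropertyC (ℋ₁ ⊗ ℋ₂)
lemma9 n V₁ V₂ ℋ₁ ℋ₂ V₁∩V₂-empty (ℋ₁⊆V₁ , _) (ℋ₂⊆V₂ , _) C₁ C₂ _ _
       (A₁ , A₂ , A₁∈ℋ₁ , A₂∈ℋ₂ , refl) (B₁ , B₂ , B₁∈ℋ₁ , B₂∈ℋ₂ , refl) _ =
  Walk⇒Chain (first ++ second) ⊆-refl
  where
  disjoint : ∀ {E₁ E₂} → ℋ₁ E₁ → ℋ₂ E₂ → Empty (E₁ ∩ E₂)
  disjoint E₁∈ℋ₁ E₂∈ℋ₂ = Empty-∩-antimono (ℋ₁⊆V₁ _ E₁∈ℋ₁) (ℋ₂⊆V₂ _ E₂∈ℋ₂) V₁∩V₂-empty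

  S : Subset n
  S = (A₁ ∪ A₂) ∪ (B₁ ∪ B₂)

  A₁⊆S : A₁ ⊆ S
  A₁⊆S = ⊆-trans (p⊆p∪q A₂) (p⊆p∪q (B₁ ∪ B₂))
  A₂⊆S : A₂ ⊆ S
  A₂⊆S = ⊆-trans (q⊆p∪q A₁ A₂) (p⊆p∪q (B₁ ∪ B₂))
  B₁⊆S : B₁ ⊆ S
  B₁⊆S = ⊆-trans (p⊆p∪q B₂) (q⊆p∪q (A₁ ∪ A₂) (B₁ ∪ B₂))
  B₂⊆S : B₂ ⊆ S
  B₂⊆S = ⊆-trans (q⊆p∪q B₁ B₂) (q⊆p∪q (A₁ ∪ A₂) (B₁ ∪ B₂))

  first : Walk (ℋ₁ ⊗ ℋ₂) S (A₁ ∪ A₂) (B₁ ∪ A₂)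
  first = map (_∪ A₂) (λ X∈ℋ₁ → _ , A₂ , X∈ℋ₁ , A₂∈ℋ₂ , refl)
            (λ X⊆ → ∪-⊆ (⊆-trans X⊆ (∪-⊆ A₁⊆S B₁⊆S)) A₂⊆S)
            (λ Y∈ℋ₁ → Adjacent-∪ʳ A₂ (disjoint Y∈ℋ₁ A₂∈ℋ₂))
            (PropertyC⇒Walk C₁ A₁∈ℋ₁ B₁∈ℋ₁)

  second : Walk (ℋ₁ ⊗ ℋ₂) S (B₁ ∪ A₂) (B₁ ∪ B₂)
  second = map (B₁ ∪_) (λ X∈ℋ₂ → B₁ , _ , B₁∈ℋ₁ , X∈ℋ₂ , refl)
             (λ X⊆ → ∪-⊆ B₁⊆S (⊆-trans X⊆ (∪-⊆ A₂⊆S B₂⊆S)))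
             (λ Y∈ℋ₂ → Adjacent-∪ˡ B₁ (disjoint B₁∈ℋ₁ Y∈ℋ₂))
             (PropertyC⇒Walk C₂ A₂∈ℋ₂ B₂∈ℋ₂)
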